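{- Let $k,r\in\mathbb{N}$. For all sufficiently large $n>k$ the following holds. Let $g\colon\mathbb{N}\to\mathbb{N}$ be any function such that there exists a $g$-code $E\colon\binom{[n]}{k}\to\binom{[m]}{r}$. If $\ell\le k$ and $\mathcal{F}\subseteq\binom{[n]}{\ell}$ is a sunflower with kernel $y\in\binom{[n]}{\ell'}$, then $E_\ell(\mathcal{F})=\{E_\ell(x):x\in\mathcal{F}\}$ is a sunflower with kernel $E_{\ell'}(y)$.
   Context: Strings in $\{0,1\}^n$ are identified with subsets of $[n]$; $\binom{[n]}{j}$ is the set of $j$-element subsets of $[n]$, and $\mathrm{dist}$ is Hamming distance (size of symmetric difference). $E$ is a $g$-code if $\mathrm{dist}(E(x),E(y))=g(\mathrm{dist}(x,y))$ for all $x,y\in\binom{[n]}{k}$. For $\ell\le k$, $E_\ell\colon\binom{[n]}{\ell}\to\{S\subseteq[m]:|S|\le r\}$ is defined by $E_\ell(y)=\bigcap_{x\supseteq y,\ x\in\binom{[n]}{k}}E(x)$. A sunflower is a collection of sets $F_1,\dots,F_t$ for which there is a set $K$ (the kernel) with $F_i\cap F_j=K$ for all $i\ne j$. -}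

module Defs where

open import Data.Nat using (ℕ; zero; suc; _≟_)
open import Data.Bool using (Bool; true; false)
open import Data.Vec using (Vec; []; _∷_)
open import Data.List using (List; []; _∷_; map; filter; _++_)
open import Data.Product using (_×_; ∃)
open import Data.Fin.Subset using (Subset; _∩_; _∪_; _─_; ∣_∣; ⋂; _⊆_; inside; outside)
open import Data.Fin.Subset.Properties using (_⊆?_)
open import Relation.Nullary using (¬_)
open import Relation.Nullary.Decidable using (_×-dec_)
open import Relation.Binary.PropositionalEquality using (_≡_)

allSubsets : (n : ℕ) → List (Subset n)
allSubsets zero = [] ∷ []
allSubsets (suc n) = map (outside ∷_) (allSubsets n) ++ map (inside ∷_) (allSubsets n)

dist : {n : ℕ} → Subset n → Subset n → ℕ
dist x y = ∣ (x ─ y) ∪ (y ─ x) ∣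

-- E maps k-subsets of [n] to r-subsets of [m]
-- (E is a total function; only its values on k-subsets matter).
MapsInto : {n m : ℕ} → (k r : ℕ) → (Subset n → Subset m) → Set
MapsInto k r E = ∀ x → ∣ x ∣ ≡ k → ∣ E x ∣ ≡ r

IsGCode : {n m : ℕ} → (k : ℕ) → (ℕ → ℕ) → (Subset n → Subset m) → Set
IsGCode k g E = ∀ x y → ∣ x ∣ ≡ k → ∣ y ∣ ≡ k → dist (E x) (E y) ≡ g (dist x y)

-- E_ℓ(y) = ⋂ { E(x) : x ∈ ([n] choose k), y ⊆ x }  (empty intersection = [m]).
Ebar : {n m : ℕ} → (k : ℕ) → (Subset n → Subset m) → Subset n → Subset m
Ebar {n} k E y = ⋂ (map E (filter (λ x → (∣ x ∣ ≟ k) ×-dec (y ⊆? x)) (allSubsets n)))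

IsSunflowerWithKernel : {n : ℕ} → (Subset n → Set) → Subset n → Set
IsSunflowerWithKernel 𝓕 K = ∀ a b → 𝓕 a → 𝓕 b → ¬ (a ≡ b) → a ∩ b ≡ K

ImageFamily : {n m : ℕ} → (Subset n → Subset m) → (Subset n → Set) → Subset m → Set
ImageFamily f 𝓕 z = ∃ λ x → 𝓕 x × f x ≡ z

-- For k-sets u, v we have dist u v = 2k − 2∣u ∩ v∣, so for a g-code ∣E u ∩ E v∣
-- depends only on ∣u ∩ v∣. Let s₀, s₁, s₂ be k-sets pairwise meeting exactly in w. Adding many
-- fresh petals w ∪ R (this is where n must be large) gives a big sunflower with kernel w, whose
-- images are r-sets pairwise meeting in t = ∣E s₁ ∩ E s₂∣ points and meeting each E sᵢ in t
-- points. By Deza's argument they contain a common t-set T, and every r-set meeting all of them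
-- in t points contains T; hence E s₁ ∩ E s₂ = T ⊆ E s₀. Choosing such triples shows that a point
-- lying in E x for all k-supersets x of a and of b (∣a∣ = ∣b∣ ≤ k) lies in E z for every k-superset
-- z of a ∩ b, i.e. E_ℓ(a) ∩ E_ℓ(b) = E_ℓ(a ∩ b). For a sunflower a ∩ b is the kernel.
module Submission where

open import Data.Bool using (true; false)
open import Data.Fin using (Fin; zero; suc)
open import Data.Fin.Subset
open import Data.Fin.Subset.Properties
open import Data.List using (List; []; _∷_; length; map; filter)
open import Data.List.Membership.Propositional using () renaming (_∈_ to _∈ₗ_)
open import Data.List.Membership.Propositional.Properties using (∈-++⁺ˡ; ∈-++⁺ʳ; ∈-map⁺; ∈-filter⁺; ∈-filter⁻)
open import Data.List.Properties using (length-map)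
open import Data.List.Relation.Binary.Sublist.Propositional using ([]; _∷_; _∷ʳ_)
  renaming (_⊆_ to _⊑_; ⊆-refl to ⊑-refl; ⊆-trans to ⊑-trans)
open import Data.List.Relation.Binary.Sublist.Propositional.Properties using ()
  renaming (All-resp-⊆ to All-resp-⊑; filter-⊆ to filter-⊑)
open import Data.List.Relation.Unary.All as All using (All; []; _∷_)
open import Data.List.Relation.Unary.All.Properties as All using (all-filter)
open import Data.List.Relation.Unary.AllPairs using (AllPairs; []; _∷_)
import Data.List.Relation.Unary.AllPairs.Properties as AllPairs
open import Data.List.Relation.Unary.Any using (here)
open import Data.Nat using (ℕ; zero; suc; _+_; _*_; _∸_; _≤_; _<_; z≤n; s≤s; _≟_)
open import Data.Nat.Properties
open import Data.Product using (_×_; _,_; ∃; ∃₂; proj₁; proj₂; uncurry)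
open import Data.Sum using (_⊎_; inj₁; inj₂)
open import Data.Vec using ([]; _∷_; here; there)
open import Function using (_∘_)
open import Relation.Binary.PropositionalEquality
open import Relation.Nullary using (yes; no; contradiction)
open import Relation.Nullary.Decidable using (_×-dec_)
open import Relation.Unary using (Decidable)
open import Relation.Unary.Properties using (∁?)

open import Defs

∣p∪q∣+∣p∩q∣≡∣p∣+∣q∣ : ∀ {n} (p q : Subset n) → ∣ p ∪ q ∣ + ∣ p ∩ q ∣ ≡ ∣ p ∣ + ∣ q ∣
∣p∪q∣+∣p∩q∣≡∣p∣+∣q∣ []          []          = refl
∣p∪q∣+∣p∩q∣≡∣p∣+∣q∣ (true ∷ p)  (true ∷ q)  =
  cong suc (trans (+-suc _ _) (trans (cong suc (∣p∪q∣+∣p∩q∣≡∣p∣+∣q∣ p q)) (sym (+-suc _ _))))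
∣p∪q∣+∣p∩q∣≡∣p∣+∣q∣ (true ∷ p)  (false ∷ q) = cong suc (∣p∪q∣+∣p∩q∣≡∣p∣+∣q∣ p q)
∣p∪q∣+∣p∩q∣≡∣p∣+∣q∣ (false ∷ p) (true ∷ q)  = trans (cong suc (∣p∪q∣+∣p∩q∣≡∣p∣+∣q∣ p q)) (sym (+-suc _ _))
∣p∪q∣+∣p∩q∣≡∣p∣+∣q∣ (false ∷ p) (false ∷ q) = ∣p∪q∣+∣p∩q∣≡∣p∣+∣q∣ p q

∣p∪q∣≤∣p∣+∣q∣ : ∀ {n} (p q : Subset n) → ∣ p ∪ q ∣ ≤ ∣ p ∣ + ∣ q ∣
∣p∪q∣≤∣p∣+∣q∣ p q = subst (∣ p ∪ q ∣ ≤_) (∣p∪q∣+∣p∩q∣≡∣p∣+∣q∣ p q) (m≤m+n _ _)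

dist+2∣p∩q∣≡∣p∣+∣q∣ : ∀ {n} (p q : Subset n) → dist p q + 2 * ∣ p ∩ q ∣ ≡ ∣ p ∣ + ∣ q ∣
dist+2∣p∩q∣≡∣p∣+∣q∣ []          []          = refl
dist+2∣p∩q∣≡∣p∣+∣q∣ (true ∷ p)  (true ∷ q)  = begin
  dist p q + 2 * suc ∣ p ∩ q ∣   ≡⟨ cong (dist p q +_) (*-suc 2 ∣ p ∩ q ∣) ⟩
  dist p q + (2 + 2 * ∣ p ∩ q ∣) ≡⟨ +-comm (dist p q) _ ⟩
  2 + (2 * ∣ p ∩ q ∣ + dist p q) ≡⟨ cong (2 +_) (trans (+-comm _ (dist p q)) (dist+2∣p∩q∣≡∣p∣+∣q∣ p q)) ⟩
  2 + (∣ p ∣ + ∣ q ∣)            ≡⟨ cong suc (sym (+-suc ∣ p ∣ ∣ q ∣)) ⟩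
  suc ∣ p ∣ + suc ∣ q ∣          ∎
  where open ≡-Reasoning
dist+2∣p∩q∣≡∣p∣+∣q∣ (true ∷ p)  (false ∷ q) = cong suc (dist+2∣p∩q∣≡∣p∣+∣q∣ p q)
dist+2∣p∩q∣≡∣p∣+∣q∣ (false ∷ p) (true ∷ q)  = trans (cong suc (dist+2∣p∩q∣≡∣p∣+∣q∣ p q)) (sym (+-suc _ _))
dist+2∣p∩q∣≡∣p∣+∣q∣ (false ∷ p) (false ∷ q) = dist+2∣p∩q∣≡∣p∣+∣q∣ p q

∣∩∣≡⇒dist≡ : ∀ {n} (p q p′ q′ : Subset n) → ∣ p ∣ + ∣ q ∣ ≡ ∣ p′ ∣ + ∣ q′ ∣ →
             ∣ p ∩ q ∣ ≡ ∣ p′ ∩ q′ ∣ → dist p q ≡ dist p′ q′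
∣∩∣≡⇒dist≡ p q p′ q′ sizes ∣p∩q∣≡∣p′∩q′∣ = +-cancelʳ-≡ (2 * ∣ p′ ∩ q′ ∣) _ _ (begin
  dist p q + 2 * ∣ p′ ∩ q′ ∣   ≡⟨ cong (λ i → dist p q + 2 * i) (sym ∣p∩q∣≡∣p′∩q′∣) ⟩
  dist p q + 2 * ∣ p ∩ q ∣     ≡⟨ dist+2∣p∩q∣≡∣p∣+∣q∣ p q ⟩
  ∣ p ∣ + ∣ q ∣                ≡⟨ sizes ⟩
  ∣ p′ ∣ + ∣ q′ ∣              ≡⟨ dist+2∣p∩q∣≡∣p∣+∣q∣ p′ q′ ⟨
  dist p′ q′ + 2 * ∣ p′ ∩ q′ ∣ ∎)
  where open ≡-Reasoning

dist≡⇒∣∩∣≡ : ∀ {n} (p q p′ q′ : Subset n) → ∣ p ∣ + ∣ q ∣ ≡ ∣ p′ ∣ + ∣ q′ ∣ →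
             dist p q ≡ dist p′ q′ → ∣ p ∩ q ∣ ≡ ∣ p′ ∩ q′ ∣
dist≡⇒∣∩∣≡ p q p′ q′ sizes dist≡ = *-cancelˡ-≡ _ _ 2 (+-cancelˡ-≡ (dist p q) _ _ (begin
  dist p q + 2 * ∣ p ∩ q ∣     ≡⟨ dist+2∣p∩q∣≡∣p∣+∣q∣ p q ⟩
  ∣ p ∣ + ∣ q ∣                ≡⟨ sizes ⟩
  ∣ p′ ∣ + ∣ q′ ∣              ≡⟨ dist+2∣p∩q∣≡∣p∣+∣q∣ p′ q′ ⟨
  dist p′ q′ + 2 * ∣ p′ ∩ q′ ∣ ≡⟨ cong (_+ 2 * ∣ p′ ∩ q′ ∣) dist≡ ⟨
  dist p q + 2 * ∣ p′ ∩ q′ ∣   ∎))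
  where open ≡-Reasoning

⊆-or-∃∉ : ∀ {n} (p q : Subset n) → p ⊆ q ⊎ ∃ λ x → x ∈ p × x ∉ q
⊆-or-∃∉ [] [] = inj₁ (λ ())
⊆-or-∃∉ (_ ∷ p) (_ ∷ q) with ⊆-or-∃∉ p q
... | inj₂ (x , x∈p , x∉q)  = inj₂ (suc x , there x∈p , x∉q ∘ drop-there)
⊆-or-∃∉ (false ∷ p) (_ ∷ q)     | inj₁ p⊆q = inj₁ (out⊆ p⊆q)
⊆-or-∃∉ (true ∷ p)  (true ∷ q)  | inj₁ p⊆q = inj₁ (in⊆in p⊆q)
⊆-or-∃∉ (true ∷ p)  (false ∷ q) | inj₁ _   = inj₂ (zero , here , λ ())

∣q∣<∣p∣⇒∃∈p∉q : ∀ {n} {p q : Subset n} → ∣ q ∣ < ∣ p ∣ → ∃ λ x → x ∈ p × x ∉ q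
∣q∣<∣p∣⇒∃∈p∉q {p = p} {q} ∣q∣<∣p∣ with ⊆-or-∃∉ p q
... | inj₁ p⊆q = contradiction (p⊆q⇒∣p∣≤∣q∣ p⊆q) (<⇒≱ ∣q∣<∣p∣)
... | inj₂ wit = wit

p⊆q⇒∣q∣≤∣p∣⇒q⊆p : ∀ {n} {p q : Subset n} → p ⊆ q → ∣ q ∣ ≤ ∣ p ∣ → q ⊆ p
p⊆q⇒∣q∣≤∣p∣⇒q⊆p {p = p} {q} p⊆q ∣q∣≤∣p∣ with ⊆-or-∃∉ q p
... | inj₁ q⊆p = q⊆p
... | inj₂ (x , x∈q , x∉p) = contradiction ∣q∣≤∣p∣ (<⇒≱ (p⊂q⇒∣p∣<∣q∣ (p⊆q , x , x∈q , x∉p)))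

p⊆q⇒q∩p≡p : ∀ {n} {p q : Subset n} → p ⊆ q → q ∩ p ≡ p
p⊆q⇒q∩p≡p {p = p} {q} p⊆q = ⊆-antisym (p∩q⊆q q p) (λ x∈p → x∈p∩q⁺ (p⊆q x∈p , x∈p))

∪⁅⁆-⊆ : ∀ {n} {p q : Subset n} {x : Fin n} → p ⊆ q → x ∈ q → p ∪ ⁅ x ⁆ ⊆ q
∪⁅⁆-⊆ {p = p} {q} {x} p⊆q x∈q y∈p∪⁅x⁆ with x∈p∪q⁻ p ⁅ x ⁆ y∈p∪⁅x⁆
... | inj₁ y∈p    = p⊆q y∈p
... | inj₂ y∈⁅x⁆ = subst (_∈ q) (sym (x∈⁅y⁆⇒x≡y x y∈⁅x⁆)) x∈q

Disjoint : ∀ {n} → Subset n → Subset n → Set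
Disjoint p q = p ∩ q ≡ ⊥

Disjoint-sym : ∀ {n} {p q : Subset n} → Disjoint p q → Disjoint q p
Disjoint-sym {p = p} {q} p∩q≡⊥ = trans (∩-comm q p) p∩q≡⊥

Disjoint⁺ : ∀ {n} {p q : Subset n} → (∀ {x} → x ∈ p → x ∉ q) → Disjoint p q
Disjoint⁺ {p = p} {q} p∌q = Empty-unique λ (x , x∈p∩q) → let (x∈p , x∈q) = x∈p∩q⁻ p q x∈p∩q in p∌q x∈p x∈q

Disjoint-⊆ʳ : ∀ {n} {p q q′ : Subset n} → q′ ⊆ q → Disjoint p q → Disjoint p q′
Disjoint-⊆ʳ q′⊆q p∩q≡⊥ = Disjoint⁺ λ x∈p x∈q′ →
  ∉⊥ (subst (_ ∈_) p∩q≡⊥ (x∈p∩q⁺ (x∈p , q′⊆q x∈q′)))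

Disjoint-∪⁻ : ∀ {n} {p q r : Subset n} → Disjoint p (q ∪ r) → Disjoint p q × Disjoint p r
Disjoint-∪⁻ {q = q} {r} p∩[q∪r]≡⊥ = Disjoint-⊆ʳ (p⊆p∪q r) p∩[q∪r]≡⊥ , Disjoint-⊆ʳ (q⊆p∪q q r) p∩[q∪r]≡⊥

Disjoint⇒p∩[q∪r]≡p∩q : ∀ {n} {p r : Subset n} (q : Subset n) → Disjoint p r → p ∩ (q ∪ r) ≡ p ∩ q
Disjoint⇒p∩[q∪r]≡p∩q {p = p} {r} q p∩r≡⊥ = begin
  p ∩ (q ∪ r)       ≡⟨ ∩-distribˡ-∪ p q r ⟩
  (p ∩ q) ∪ (p ∩ r) ≡⟨ cong ((p ∩ q) ∪_) p∩r≡⊥ ⟩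
  (p ∩ q) ∪ ⊥       ≡⟨ ∪-identityʳ (p ∩ q) ⟩
  p ∩ q             ∎
  where open ≡-Reasoning

[p∪r]∩[q∪s]≡p∩q : ∀ {n} {p q r s : Subset n} → Disjoint r q → Disjoint p s → Disjoint r s →
                    (p ∪ r) ∩ (q ∪ s) ≡ p ∩ q
[p∪r]∩[q∪s]≡p∩q {p = p} {q} {r} {s} r∩q≡⊥ p∩s≡⊥ r∩s≡⊥ = begin
  (p ∪ r) ∩ (q ∪ s)               ≡⟨ ∩-distribʳ-∪ (q ∪ s) p r ⟩
  (p ∩ (q ∪ s)) ∪ (r ∩ (q ∪ s))   ≡⟨ cong₂ _∪_ (Disjoint⇒p∩[q∪r]≡p∩q q p∩s≡⊥) (Disjoint⇒p∩[q∪r]≡p∩q q r∩s≡⊥) ⟩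
  (p ∩ q) ∪ (r ∩ q)               ≡⟨ cong ((p ∩ q) ∪_) r∩q≡⊥ ⟩
  (p ∩ q) ∪ ⊥                     ≡⟨ ∪-identityʳ (p ∩ q) ⟩
  p ∩ q                           ∎
  where open ≡-Reasoning

x∩[w∪R]≡w : ∀ {n} {w x R : Subset n} → w ⊆ x → Disjoint R x → x ∩ (w ∪ R) ≡ w
x∩[w∪R]≡w {w = w} w⊆x R∩x≡⊥ = trans (Disjoint⇒p∩[q∪r]≡p∩q w (Disjoint-sym R∩x≡⊥)) (p⊆q⇒q∩p≡p w⊆x)

Disjoint⇒∣p∪q∣≡∣p∣+∣q∣ : ∀ {n} {p q : Subset n} → Disjoint p q → ∣ p ∪ q ∣ ≡ ∣ p ∣ + ∣ q ∣
Disjoint⇒∣p∪q∣≡∣p∣+∣q∣ {n} {p} {q} p∩q≡⊥ = begin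
  ∣ p ∪ q ∣             ≡⟨ sym (+-identityʳ _) ⟩
  ∣ p ∪ q ∣ + 0         ≡⟨ cong (∣ p ∪ q ∣ +_) (sym (trans (cong ∣_∣ p∩q≡⊥) (∣⊥∣≡0 n))) ⟩
  ∣ p ∪ q ∣ + ∣ p ∩ q ∣ ≡⟨ ∣p∪q∣+∣p∩q∣≡∣p∣+∣q∣ p q ⟩
  ∣ p ∣ + ∣ q ∣         ∎
  where open ≡-Reasoning

∣p∪q∣≡k : ∀ {n k} {p q : Subset n} → ∣ p ∣ ≤ k → ∣ q ∣ ≡ k ∸ ∣ p ∣ → Disjoint p q → ∣ p ∪ q ∣ ≡ k
∣p∪q∣≡k {p = p} ∣p∣≤k ∣q∣≡k∸∣p∣ p∩q≡⊥ =
  trans (Disjoint⇒∣p∪q∣≡∣p∣+∣q∣ p∩q≡⊥) (trans (cong (∣ p ∣ +_) ∣q∣≡k∸∣p∣) (m+[n∸m]≡n ∣p∣≤k))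

fresh : ∀ {n} (U : Subset n) (j : ℕ) → ∣ U ∣ + j ≤ n → ∃ λ R → ∣ R ∣ ≡ j × Disjoint R U
fresh {n} U zero _ = ⊥ , ∣⊥∣≡0 n , ∩-zeroˡ U
fresh {zero}  []            (suc j) ()
fresh {suc n} (true ∷ U)    j       (s≤s room) with fresh U j room
... | R , ∣R∣≡j , R∩U≡⊥ = false ∷ R , ∣R∣≡j , cong (false ∷_) R∩U≡⊥
fresh {suc n} (false ∷ U)   (suc j) room with fresh U j (≤-pred (subst (_≤ suc n) (+-suc ∣ U ∣ j) room))
... | R , ∣R∣≡j , R∩U≡⊥ = true ∷ R , cong suc ∣R∣≡j , cong (false ∷_) R∩U≡⊥

petals : ∀ {n} (U : Subset n) (i c : ℕ) → ∣ U ∣ + i * c ≤ n →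
         ∃ λ L → length L ≡ i × All (λ R → ∣ R ∣ ≡ c × Disjoint R U) L × AllPairs Disjoint L
petals U zero    c _    = [] , refl , [] , []
petals {n} U (suc i) c room with fresh U c (≤-trans (+-monoʳ-≤ ∣ U ∣ (m≤m+n c (i * c))) room)
... | R , ∣R∣≡c , R∩U≡⊥ with petals (U ∪ R) i c room′
  where
  room′ : ∣ U ∪ R ∣ + i * c ≤ n
  room′ = ≤-trans (+-monoˡ-≤ (i * c) (≤-trans (∣p∪q∣≤∣p∣+∣q∣ U R) (≤-reflexive (cong (∣ U ∣ +_) ∣R∣≡c))))
                  (≤-trans (≤-reflexive (+-assoc ∣ U ∣ c (i * c))) room)
... | L , ∣L∣≡i , fresh-L , disjoint-L =
  R ∷ L , cong suc ∣L∣≡i ,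
  (∣R∣≡c , R∩U≡⊥) ∷ All.map (λ (∣R′∣≡c , R′∩[U∪R]≡⊥) → ∣R′∣≡c , proj₁ (Disjoint-∪⁻ R′∩[U∪R]≡⊥)) fresh-L ,
  All.map (λ (_ , R′∩[U∪R]≡⊥) → Disjoint-sym (proj₂ (Disjoint-∪⁻ R′∩[U∪R]≡⊥))) fresh-L ∷ disjoint-L

module _ {a} {A : Set a} where

  AllPairs-resp-⊑ : ∀ {ℓ} {R : A → A → Set ℓ} {xs ys : List A} → xs ⊑ ys → AllPairs R ys → AllPairs R xs
  AllPairs-resp-⊑ []             []         = []
  AllPairs-resp-⊑ (_ ∷ʳ xs⊑ys)   (_ ∷ rys)  = AllPairs-resp-⊑ xs⊑ys rys
  AllPairs-resp-⊑ (refl ∷ xs⊑ys) (ry ∷ rys) = All-resp-⊑ xs⊑ys ry ∷ AllPairs-resp-⊑ xs⊑ys rys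

  AllPairs-mapWithAll : ∀ {p ℓ ℓ′} {P : A → Set p} {R : A → A → Set ℓ} {S : A → A → Set ℓ′} →
                        (∀ {x y} → P x → P y → R x y → S x y) →
                        ∀ {xs} → All P xs → AllPairs R xs → AllPairs S xs
  AllPairs-mapWithAll f []         []         = []
  AllPairs-mapWithAll f (px ∷ pxs) (rx ∷ rxs) =
    All.zipWith (λ (py , rxy) → f px py rxy) (pxs , rx) ∷ AllPairs-mapWithAll f pxs rxs

  pair-of-length-2 : ∀ {p ℓ} {P : A → Set p} {R : A → A → Set ℓ} (xs : List A) → length xs ≡ 2 →
                     All P xs → AllPairs R xs → ∃₂ λ x y → P x × P y × R x y
  pair-of-length-2 (x ∷ y ∷ []) _ (px ∷ py ∷ []) ((rxy ∷ []) ∷ _) = x , y , px , py , rxy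

  length-filter+length-filter-∁ : ∀ {p} {P : A → Set p} (P? : Decidable P) (xs : List A) →
    length (filter P? xs) + length (filter (∁? P?) xs) ≡ length xs
  length-filter+length-filter-∁ P? []       = refl
  length-filter+length-filter-∁ P? (x ∷ xs) with P? x
  ... | yes _ = cong suc (length-filter+length-filter-∁ P? xs)
  ... | no  _ = trans (+-suc _ _) (cong suc (length-filter+length-filter-∁ P? xs))

-- Enough sets for grow-kernel when d points of the common kernel are still missing.
dezaBound : ℕ → ℕ → ℕ
dezaBound r zero    = r
dezaBound r (suc d) = suc (r * dezaBound r d + dezaBound r d)

dezaBound-mono : ∀ r {d e} → d ≤ e → dezaBound r d ≤ dezaBound r e
dezaBound-mono r {zero}  {zero}  z≤n       = ≤-refl
dezaBound-mono r {zero}  {suc e} z≤n       = m≤n⇒m≤1+n (≤-trans (dezaBound-mono r {e = e} z≤n) (m≤n+m _ _))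
dezaBound-mono r {suc d} {suc e} (s≤s d≤e) =
  s≤s (+-mono-≤ (*-monoʳ-≤ r (dezaBound-mono r d≤e)) (dezaBound-mono r d≤e))

pigeonhole : ∀ {m} (q s : ℕ) (S : Subset m) (L : List (Subset m)) →
             ∣ S ∣ ≤ s → All (λ Y → ∃ λ c → c ∈ S × c ∈ Y) L → s * q < length L →
             ∃ λ c → c ∈ S × ∃ λ L′ → L′ ⊑ L × All (c ∈_) L′ × q < length L′
pigeonhole q s S [] _ [] ()
pigeonhole q zero S (_ ∷ _) ∣S∣≤0 ((c , c∈S , _) ∷ _) _ =
  contradiction (≤-trans (x∈p⇒∣p-x∣<∣p∣ c∈S) ∣S∣≤0) λ ()
pigeonhole q (suc s) S L ∣S∣≤1+s meets@((c₀ , c₀∈S , _) ∷ _) q+s*q<∣L∣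
  with q <? length (filter (c₀ ∈?_) L)
... | yes q<∣L₀∣ = c₀ , c₀∈S , filter (c₀ ∈?_) L , filter-⊑ (c₀ ∈?_) L , all-filter (c₀ ∈?_) L , q<∣L₀∣
... | no  q≮∣L₀∣ with pigeonhole q s (S - c₀) (filter (∁? (c₀ ∈?_)) L) ∣S-c₀∣≤s meets′ s*q<∣L′∣
  where
  ∣S-c₀∣≤s : ∣ S - c₀ ∣ ≤ s
  ∣S-c₀∣≤s = ≤-pred (≤-trans (x∈p⇒∣p-x∣<∣p∣ c₀∈S) ∣S∣≤1+s)
  meets′ : All (λ Y → ∃ λ c → c ∈ S - c₀ × c ∈ Y) (filter (∁? (c₀ ∈?_)) L)
  meets′ = All.zipWith (λ ((c , c∈S , c∈Y) , c₀∉Y) → c , x∈p∧x≢y⇒x∈p-y c∈S (λ { refl → c₀∉Y c∈Y }) , c∈Y)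
                       (All.filter⁺ (∁? (c₀ ∈?_)) meets , all-filter (∁? (c₀ ∈?_)) L)
  s*q<∣L′∣ : s * q < length (filter (∁? (c₀ ∈?_)) L)
  s*q<∣L′∣ = +-cancelˡ-< q _ _ (<-≤-trans q+s*q<∣L∣
    (≤-trans (≤-reflexive (sym (length-filter+length-filter-∁ (c₀ ∈?_) L))) (+-monoˡ-≤ _ (≮⇒≥ q≮∣L₀∣))))
... | c , c∈S-c₀ , L′ , L′⊑ , c∈L′ , q<∣L′∣ =
  c , p─q⊆p S ⁅ c₀ ⁆ c∈S-c₀ , L′ , ⊑-trans L′⊑ (filter-⊑ (∁? (c₀ ∈?_)) L) , c∈L′ , q<∣L′∣

-- Every later member Y meets X outside T, as ∣X ∩ Y∣ = t > ∣T∣; by pigeonhole on X ∖ T some c lies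
-- in many of them, and T ∪ {c} is a larger common subset.
grow-kernel : ∀ {m} (r t d : ℕ) (T : Subset m) (L : List (Subset m)) → ∣ T ∣ + d ≡ t → All (T ⊆_) L →
              All (λ X → ∣ X ∣ ≤ r) L → AllPairs (λ X Y → ∣ X ∩ Y ∣ ≡ t) L → dezaBound r d < length L →
              ∃ λ T′ → ∣ T′ ∣ ≡ t × ∃ λ L′ → L′ ⊑ L × All (T′ ⊆_) L′ × r < length L′
grow-kernel r t zero T L ∣T∣+0≡t T⊆L _ _ r<∣L∣ = T , trans (sym (+-identityʳ _)) ∣T∣+0≡t , L , ⊑-refl , T⊆L , r<∣L∣
grow-kernel r t (suc d) T (X ∷ L) ∣T∣+1+d≡t (_ ∷ T⊆L) (∣X∣≤r ∷ ∣L∣≤r) (∣X∩L∣≡t ∷ ∣L∩L∣≡t) (s≤s bound)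
  with pigeonhole (dezaBound r d) r (X ∩ ∁ T) L (≤-trans (∣p∩q∣≤∣p∣ X (∁ T)) ∣X∣≤r) (All.map meet ∣X∩L∣≡t)
                  (≤-<-trans (m≤m+n _ _) bound)
  where
  meet : ∀ {Y} → ∣ X ∩ Y ∣ ≡ t → ∃ λ c → c ∈ X ∩ ∁ T × c ∈ Y
  meet {Y} ∣X∩Y∣≡t =
    let (c , c∈X∩Y , c∉T) = ∣q∣<∣p∣⇒∃∈p∉q ∣T∣<∣X∩Y∣
        (c∈X , c∈Y)       = x∈p∩q⁻ X Y c∈X∩Y
    in c , x∈p∩q⁺ (c∈X , x∉p⇒x∈∁p c∉T) , c∈Y
    where
    ∣T∣<∣X∩Y∣ : ∣ T ∣ < ∣ X ∩ Y ∣
    ∣T∣<∣X∩Y∣ = subst (∣ T ∣ <_) (trans ∣T∣+1+d≡t (sym ∣X∩Y∣≡t)) (m<m+n ∣ T ∣ (s≤s z≤n))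
... | c , c∈X∖T , L₁ , L₁⊑L , c∈L₁ , bound₁
  with grow-kernel r t d (T ∪ ⁅ c ⁆) L₁ ∣T∪c∣+d≡t
         (All.zipWith (uncurry ∪⁅⁆-⊆) (All-resp-⊑ L₁⊑L T⊆L , c∈L₁))
         (All-resp-⊑ L₁⊑L ∣L∣≤r) (AllPairs-resp-⊑ L₁⊑L ∣L∩L∣≡t) bound₁
  where
  c∉T : c ∉ T
  c∉T = x∈∁p⇒x∉p (proj₂ (x∈p∩q⁻ X (∁ T) c∈X∖T))
  ∣T∪c∣+d≡t : ∣ T ∪ ⁅ c ⁆ ∣ + d ≡ t
  ∣T∪c∣+d≡t = begin
    ∣ T ∪ ⁅ c ⁆ ∣ + d       ≡⟨ cong (_+ d) (Disjoint⇒∣p∪q∣≡∣p∣+∣q∣ T∩c≡⊥) ⟩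
    ∣ T ∣ + ∣ ⁅ c ⁆ ∣ + d   ≡⟨ cong (λ s → ∣ T ∣ + s + d) (∣⁅x⁆∣≡1 c) ⟩
    ∣ T ∣ + 1 + d           ≡⟨ +-assoc ∣ T ∣ 1 d ⟩
    ∣ T ∣ + suc d           ≡⟨ ∣T∣+1+d≡t ⟩
    t                       ∎
    where
    open ≡-Reasoning
    T∩c≡⊥ : Disjoint T ⁅ c ⁆
    T∩c≡⊥ = Disjoint⁺ λ x∈T x∈⁅c⁆ → c∉T (subst (_∈ T) (x∈⁅y⁆⇒x≡y c x∈⁅c⁆) x∈T)
... | T′ , ∣T′∣≡t , L′ , L′⊑L₁ , T′⊆L′ , r<∣L′∣ = T′ , ∣T′∣≡t , L′ , X ∷ʳ ⊑-trans L′⊑L₁ L₁⊑L , T′⊆L′ , r<∣L′∣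

length≤∣C∣ : ∀ {m} (T C : Subset m) (L : List (Subset m)) → AllPairs (λ X Y → X ∩ Y ⊆ T) L →
             All (λ X → ∃ λ x → x ∈ C ∩ X × x ∉ T) L → length L ≤ ∣ C ∣
length≤∣C∣ T C []      _                    _ = z≤n
length≤∣C∣ T C (X ∷ L) (X∩L⊆T ∷ L∩L⊆T) ((x , x∈C∩X , x∉T) ∷ witnesses) =
  <-≤-trans (s≤s (length≤∣C∣ T (C - x) L L∩L⊆T (All.zipWith shrink (X∩L⊆T , witnesses))))
            (x∈p⇒∣p-x∣<∣p∣ (proj₁ (x∈p∩q⁻ C X x∈C∩X)))
  where
  shrink : ∀ {Y} → X ∩ Y ⊆ T × (∃ λ y → y ∈ C ∩ Y × y ∉ T) → ∃ λ y → y ∈ (C - x) ∩ Y × y ∉ T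
  shrink {Y} (X∩Y⊆T , y , y∈C∩Y , y∉T) =
    let (y∈C , y∈Y) = x∈p∩q⁻ C Y y∈C∩Y
        y≢x : y ≢ x
        y≢x = λ { refl → x∉T (X∩Y⊆T (x∈p∩q⁺ (proj₂ (x∈p∩q⁻ C X x∈C∩X) , y∈Y))) }
    in y , x∈p∩q⁺ (x∈p∧x≢y⇒x∈p-y y∈C y≢x , y∈Y) , y∉T

-- If x ∈ T ∖ C, each member X has a point of C ∩ X outside T, and these points are distinct
-- because members meet only inside T.
kernel⊆ : ∀ {m} (t : ℕ) (T C : Subset m) (L : List (Subset m)) → ∣ T ∣ ≡ t → All (T ⊆_) L →
          AllPairs (λ X Y → ∣ X ∩ Y ∣ ≡ t) L → All (λ X → ∣ C ∩ X ∣ ≡ t) L → ∣ C ∣ < length L → T ⊆ C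
kernel⊆ t T C L ∣T∣≡t T⊆L ∣L∩L∣≡t ∣C∩L∣≡t ∣C∣<∣L∣ {x} x∈T with x ∈? C
... | yes x∈C = x∈C
... | no  x∉C = contradiction (length≤∣C∣ T C L L∩L⊆T (All.map witness ∣C∩L∣≡t)) (<⇒≱ ∣C∣<∣L∣)
  where
  L∩L⊆T : AllPairs (λ X Y → X ∩ Y ⊆ T) L
  L∩L⊆T = AllPairs-mapWithAll ∩⊆T T⊆L ∣L∩L∣≡t
    where
    ∩⊆T : ∀ {X Y} → T ⊆ X → T ⊆ Y → ∣ X ∩ Y ∣ ≡ t → X ∩ Y ⊆ T
    ∩⊆T T⊆X T⊆Y ∣X∩Y∣≡t =
      p⊆q⇒∣q∣≤∣p∣⇒q⊆p (λ y∈T → x∈p∩q⁺ (T⊆X y∈T , T⊆Y y∈T)) (≤-reflexive (trans ∣X∩Y∣≡t (sym ∣T∣≡t)))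
  witness : ∀ {X} → ∣ C ∩ X ∣ ≡ t → ∃ λ y → y ∈ C ∩ X × y ∉ T
  witness {X} ∣C∩X∣≡t with ⊆-or-∃∉ (C ∩ X) T
  ... | inj₂ wit    = wit
  ... | inj₁ C∩X⊆T =
    contradiction (trans ∣C∩X∣≡t (sym ∣T∣≡t)) (<⇒≢ (p⊂q⇒∣p∣<∣q∣ (C∩X⊆T , x , x∈T , x∉C ∘ proj₁ ∘ x∈p∩q⁻ C X)))

sunflower-kernel : ∀ {m} (r t : ℕ) (Bs : List (Subset m)) → All (λ B → ∣ B ∣ ≤ r) Bs →
                   AllPairs (λ B B′ → ∣ B ∩ B′ ∣ ≡ t) Bs → dezaBound r t < length Bs →
                   ∃ λ T → ∣ T ∣ ≡ t × (∀ A → ∣ A ∣ ≤ r → All (λ B → ∣ A ∩ B ∣ ≡ t) Bs → T ⊆ A)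
sunflower-kernel {m} r t Bs ∣Bs∣≤r ∣Bs∩Bs∣≡t bound
  with grow-kernel r t t ⊥ Bs (cong (_+ t) (∣⊥∣≡0 m)) (All.universal ⊆-min Bs) ∣Bs∣≤r ∣Bs∩Bs∣≡t bound
... | T , ∣T∣≡t , L , L⊑Bs , T⊆L , r<∣L∣ =
  T , ∣T∣≡t , λ A ∣A∣≤r ∣A∩Bs∣≡t →
    kernel⊆ t T A L ∣T∣≡t T⊆L (AllPairs-resp-⊑ L⊑Bs ∣Bs∩Bs∣≡t) (All-resp-⊑ L⊑Bs ∣A∩Bs∣≡t) (≤-<-trans ∣A∣≤r r<∣L∣)

A₁∩A₂⊆A₀ : ∀ {m} (r t : ℕ) (Bs : List (Subset m)) → All (λ B → ∣ B ∣ ≤ r) Bs →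
           AllPairs (λ B B′ → ∣ B ∩ B′ ∣ ≡ t) Bs → dezaBound r t < length Bs →
           ∀ {A₀ A₁ A₂} → ∣ A₀ ∣ ≤ r → ∣ A₁ ∣ ≤ r → ∣ A₂ ∣ ≤ r →
           All (λ B → ∣ A₀ ∩ B ∣ ≡ t) Bs → All (λ B → ∣ A₁ ∩ B ∣ ≡ t) Bs → All (λ B → ∣ A₂ ∩ B ∣ ≡ t) Bs →
           ∣ A₁ ∩ A₂ ∣ ≡ t → A₁ ∩ A₂ ⊆ A₀
A₁∩A₂⊆A₀ r t Bs ∣Bs∣≤r ∣Bs∩Bs∣≡t bound {A₀} {A₁} {A₂} ∣A₀∣≤r ∣A₁∣≤r ∣A₂∣≤r
         ∣A₀∩Bs∣≡t ∣A₁∩Bs∣≡t ∣A₂∩Bs∣≡t ∣A₁∩A₂∣≡t with sunflower-kernel r t Bs ∣Bs∣≤r ∣Bs∩Bs∣≡t bound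
... | T , ∣T∣≡t , T⊆ =
  T⊆ A₀ ∣A₀∣≤r ∣A₀∩Bs∣≡t ∘ p⊆q⇒∣q∣≤∣p∣⇒q⊆p T⊆A₁∩A₂ (≤-reflexive (trans ∣A₁∩A₂∣≡t (sym ∣T∣≡t)))
  where
  T⊆A₁∩A₂ : T ⊆ A₁ ∩ A₂
  T⊆A₁∩A₂ x∈T = x∈p∩q⁺ (T⊆ A₁ ∣A₁∣≤r ∣A₁∩Bs∣≡t x∈T , T⊆ A₂ ∣A₂∣≤r ∣A₂∩Bs∣≡t x∈T)

∈⋂⁻ : ∀ {m} {e : Fin m} (L : List (Subset m)) → e ∈ ⋂ L → All (e ∈_) L
∈⋂⁻ []      _       = []
∈⋂⁻ (X ∷ L) e∈X∩⋂L = let (e∈X , e∈⋂L) = x∈p∩q⁻ X (⋂ L) e∈X∩⋂L in e∈X ∷ ∈⋂⁻ L e∈⋂L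

∈⋂⁺ : ∀ {m} {e : Fin m} {L : List (Subset m)} → All (e ∈_) L → e ∈ ⋂ L
∈⋂⁺ []           = ∈⊤
∈⋂⁺ (e∈X ∷ e∈L) = x∈p∩q⁺ (e∈X , ∈⋂⁺ e∈L)

∈-allSubsets : ∀ {n} (x : Subset n) → x ∈ₗ allSubsets n
∈-allSubsets []          = here refl
∈-allSubsets (false ∷ x) = ∈-++⁺ˡ (∈-map⁺ (false ∷_) (∈-allSubsets x))
∈-allSubsets {suc n} (true ∷ x) =
  ∈-++⁺ʳ (map (false ∷_) (allSubsets n)) (∈-map⁺ (true ∷_) (∈-allSubsets x))

module _ {n m : ℕ} (k : ℕ) (E : Subset n → Subset m) where

  private
    IsKSuperset : Subset n → Subset n → Set
    IsKSuperset y x = ∣ x ∣ ≡ k × y ⊆ x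

    isKSuperset? : ∀ y → Decidable (IsKSuperset y)
    isKSuperset? y x = (∣ x ∣ ≟ k) ×-dec (y ⊆? x)

  ∈Ebar⁻ : ∀ {e} y → e ∈ Ebar k E y → ∀ x → ∣ x ∣ ≡ k → y ⊆ x → e ∈ E x
  ∈Ebar⁻ y e∈Ebar x ∣x∣≡k y⊆x =
    All.lookup (All.map⁻ (∈⋂⁻ _ e∈Ebar)) (∈-filter⁺ (isKSuperset? y) (∈-allSubsets x) (∣x∣≡k , y⊆x))

  ∈Ebar⁺ : ∀ {e} y → (∀ x → ∣ x ∣ ≡ k → y ⊆ x → e ∈ E x) → e ∈ Ebar k E y
  ∈Ebar⁺ y e∈E = ∈⋂⁺ (All.map⁺ (All.tabulate λ x∈filter →
    let (∣x∣≡k , y⊆x) = proj₂ (∈-filter⁻ (isKSuperset? y) {xs = allSubsets n} x∈filter) in e∈E _ ∣x∣≡k y⊆x))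

  Ebar-mono : ∀ {y y′} → y ⊆ y′ → Ebar k E y ⊆ Ebar k E y′
  Ebar-mono {y} {y′} y⊆y′ e∈Ebar = ∈Ebar⁺ y′ λ x ∣x∣≡k y′⊆x → ∈Ebar⁻ y e∈Ebar x ∣x∣≡k (y′⊆x ∘ y⊆y′)

-- Room for three sets of size ≤ k and 2 + dezaBound r r disjoint fresh sets of size ≤ k.
threshold : ℕ → ℕ → ℕ
threshold k r = k + (k + k) + (2 + dezaBound r r) * k

module GCode {n m k r : ℕ} {g : ℕ → ℕ} {E : Subset n → Subset m}
             (maps : MapsInto k r E) (code : IsGCode k g E) (large : threshold k r ≤ n) where

  ∣∩∣≡⇒∣E∩E∣≡ : ∀ {u v u′ v′} → ∣ u ∣ ≡ k → ∣ v ∣ ≡ k → ∣ u′ ∣ ≡ k → ∣ v′ ∣ ≡ k →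
                ∣ u ∩ v ∣ ≡ ∣ u′ ∩ v′ ∣ → ∣ E u ∩ E v ∣ ≡ ∣ E u′ ∩ E v′ ∣
  ∣∩∣≡⇒∣E∩E∣≡ {u} {v} {u′} {v′} ∣u∣≡k ∣v∣≡k ∣u′∣≡k ∣v′∣≡k ∣u∩v∣≡∣u′∩v′∣ =
    dist≡⇒∣∩∣≡ (E u) (E v) (E u′) (E v′)
      (same-sum (maps u ∣u∣≡k) (maps v ∣v∣≡k) (maps u′ ∣u′∣≡k) (maps v′ ∣v′∣≡k)) (begin
      dist (E u) (E v)   ≡⟨ code u v ∣u∣≡k ∣v∣≡k ⟩
      g (dist u v)       ≡⟨ cong g (∣∩∣≡⇒dist≡ u v u′ v′ (same-sum ∣u∣≡k ∣v∣≡k ∣u′∣≡k ∣v′∣≡k) ∣u∩v∣≡∣u′∩v′∣) ⟩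
      g (dist u′ v′)     ≡⟨ code u′ v′ ∣u′∣≡k ∣v′∣≡k ⟨
      dist (E u′) (E v′) ∎)
    where
    open ≡-Reasoning
    same-sum : ∀ {a b c d s : ℕ} → a ≡ s → b ≡ s → c ≡ s → d ≡ s → a + b ≡ c + d
    same-sum refl refl refl refl = refl

  FreshFor : ℕ → Subset n → Subset n → Subset n → Subset n → Set
  FreshFor c s₀ s₁ s₂ R = ∣ R ∣ ≡ c × Disjoint R s₀ × Disjoint R s₁ × Disjoint R s₂

  Petals : ℕ → ℕ → Subset n → Subset n → Subset n → Set
  Petals i c s₀ s₁ s₂ = ∃ λ L → length L ≡ i × All (FreshFor c s₀ s₁ s₂) L × AllPairs Disjoint L

  PetalPair : ℕ → Subset n → Subset n → Subset n → Set
  PetalPair c s₀ s₁ s₂ = ∃₂ λ P Q → FreshFor c s₀ s₁ s₂ P × FreshFor c s₀ s₁ s₂ Q × Disjoint P Q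

  petals-around : ∀ {s₀ s₁ s₂} → ∣ s₀ ∣ ≤ k → ∣ s₁ ∣ ≤ k → ∣ s₂ ∣ ≤ k →
                 ∀ i c → i ≤ 2 + dezaBound r r → c ≤ k → Petals i c s₀ s₁ s₂
  petals-around {s₀} {s₁} {s₂} ∣s₀∣≤k ∣s₁∣≤k ∣s₂∣≤k i c i≤2+D c≤k =
    let (L , ∣L∣≡i , fresh-L , disjoint-L) = petals (s₀ ∪ s₁ ∪ s₂) i c room
    in  L , ∣L∣≡i , All.map split fresh-L , disjoint-L
    where
    ∣U∣≤3k : ∣ s₀ ∪ s₁ ∪ s₂ ∣ ≤ k + (k + k)
    ∣U∣≤3k = begin
      ∣ s₀ ∪ s₁ ∪ s₂ ∣          ≤⟨ ∣p∪q∣≤∣p∣+∣q∣ s₀ (s₁ ∪ s₂) ⟩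
      ∣ s₀ ∣ + ∣ s₁ ∪ s₂ ∣       ≤⟨ +-monoʳ-≤ ∣ s₀ ∣ (∣p∪q∣≤∣p∣+∣q∣ s₁ s₂) ⟩
      ∣ s₀ ∣ + (∣ s₁ ∣ + ∣ s₂ ∣) ≤⟨ +-mono-≤ ∣s₀∣≤k (+-mono-≤ ∣s₁∣≤k ∣s₂∣≤k) ⟩
      k + (k + k)                ∎
      where open ≤-Reasoning
    room : ∣ s₀ ∪ s₁ ∪ s₂ ∣ + i * c ≤ n
    room = ≤-trans (+-mono-≤ ∣U∣≤3k (*-mono-≤ i≤2+D c≤k)) large
    split : ∀ {R} → ∣ R ∣ ≡ c × Disjoint R (s₀ ∪ s₁ ∪ s₂) → FreshFor c s₀ s₁ s₂ R
    split (∣R∣≡c , R∩U≡⊥) = let (R∩s₀≡⊥ , R∩s₁∪s₂≡⊥) = Disjoint-∪⁻ R∩U≡⊥ in ∣R∣≡c , R∩s₀≡⊥ , Disjoint-∪⁻ R∩s₁∪s₂≡⊥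

  petal-pair-around : ∀ {s₀ s₁ s₂} → ∣ s₀ ∣ ≤ k → ∣ s₁ ∣ ≤ k → ∣ s₂ ∣ ≤ k → ∀ c → c ≤ k → PetalPair c s₀ s₁ s₂
  petal-pair-around ∣s₀∣≤k ∣s₁∣≤k ∣s₂∣≤k c c≤k =
    let (L , ∣L∣≡2 , fresh-L , disjoint-L) = petals-around ∣s₀∣≤k ∣s₁∣≤k ∣s₂∣≤k 2 c (m≤m+n 2 _) c≤k
    in  pair-of-length-2 L ∣L∣≡2 fresh-L disjoint-L

  -- As E is a g-code, any two members of the sunflower have images meeting in ∣E s₁ ∩ E s₂∣ points.
  sunflower⇒E₁∩E₂⊆E₀ : ∀ {w s₀ s₁ s₂} (Xs : List (Subset n)) →
                        All (λ x → ∣ x ∣ ≡ k) (s₀ ∷ s₁ ∷ s₂ ∷ Xs) →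
                        AllPairs (λ x y → x ∩ y ≡ w) (s₀ ∷ s₁ ∷ s₂ ∷ Xs) →
                        dezaBound r r < length Xs → E s₁ ∩ E s₂ ⊆ E s₀
  sunflower⇒E₁∩E₂⊆E₀ {w} {s₀} {s₁} {s₂} Xs (∣s₀∣≡k ∷ ∣s₁∣≡k ∷ ∣s₂∣≡k ∷ ∣Xs∣≡k)
                     ((_ ∷ _ ∷ s₀∩Xs≡w) ∷ (s₁∩s₂≡w ∷ s₁∩Xs≡w) ∷ s₂∩Xs≡w ∷ Xs∩Xs≡w) D<∣Xs∣ =
    A₁∩A₂⊆A₀ r t (map E Xs) (All.map⁺ (All.map (λ ∣x∣≡k → ≤-reflexive (maps _ ∣x∣≡k)) ∣Xs∣≡k))
      (AllPairs.map⁺ (AllPairs-mapWithAll ∣E∩E∣≡t ∣Xs∣≡k Xs∩Xs≡w)) bound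
      (∣E∣≤r ∣s₀∣≡k) (∣E∣≤r ∣s₁∣≡k) (∣E∣≤r ∣s₂∣≡k)
      (meets ∣s₀∣≡k s₀∩Xs≡w) (meets ∣s₁∣≡k s₁∩Xs≡w) (meets ∣s₂∣≡k s₂∩Xs≡w) refl
    where
    t : ℕ
    t = ∣ E s₁ ∩ E s₂ ∣
    ∣E∣≤r : ∀ {x} → ∣ x ∣ ≡ k → ∣ E x ∣ ≤ r
    ∣E∣≤r ∣x∣≡k = ≤-reflexive (maps _ ∣x∣≡k)
    ∣E∩E∣≡t : ∀ {x y} → ∣ x ∣ ≡ k → ∣ y ∣ ≡ k → x ∩ y ≡ w → ∣ E x ∩ E y ∣ ≡ t
    ∣E∩E∣≡t ∣x∣≡k ∣y∣≡k x∩y≡w = ∣∩∣≡⇒∣E∩E∣≡ ∣x∣≡k ∣y∣≡k ∣s₁∣≡k ∣s₂∣≡k (cong ∣_∣ (trans x∩y≡w (sym s₁∩s₂≡w)))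
    meets : ∀ {x} → ∣ x ∣ ≡ k → All (λ y → x ∩ y ≡ w) Xs → All (λ B → ∣ E x ∩ B ∣ ≡ t) (map E Xs)
    meets ∣x∣≡k x∩Xs≡w = All.map⁺ (All.zipWith (λ (∣y∣≡k , x∩y≡w) → ∣E∩E∣≡t ∣x∣≡k ∣y∣≡k x∩y≡w) (∣Xs∣≡k , x∩Xs≡w))
    bound : dezaBound r t < length (map E Xs)
    bound = begin-strict
      dezaBound r t ≤⟨ dezaBound-mono r (≤-trans (∣p∩q∣≤∣p∣ (E s₁) (E s₂)) (∣E∣≤r ∣s₁∣≡k)) ⟩
      dezaBound r r <⟨ D<∣Xs∣ ⟩
      length Xs     ≡⟨ length-map E Xs ⟨
      length (map E Xs) ∎
      where open ≤-Reasoning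

  E₁∩E₂⊆E₀ : ∀ {w s₀ s₁ s₂} → ∣ s₀ ∣ ≡ k → ∣ s₁ ∣ ≡ k → ∣ s₂ ∣ ≡ k →
             s₀ ∩ s₁ ≡ w → s₀ ∩ s₂ ≡ w → s₁ ∩ s₂ ≡ w → E s₁ ∩ E s₂ ⊆ E s₀
  E₁∩E₂⊆E₀ {w} {s₀} {s₁} {s₂} ∣s₀∣≡k ∣s₁∣≡k ∣s₂∣≡k s₀∩s₁≡w s₀∩s₂≡w s₁∩s₂≡w =
    from-petals (petals-around (≤-reflexive ∣s₀∣≡k) (≤-reflexive ∣s₁∣≡k) (≤-reflexive ∣s₂∣≡k)
                              (suc (dezaBound r r)) (k ∸ ∣ w ∣) (n≤1+n _) (m∸n≤m k ∣ w ∣))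
    where
    w⊆s₀ : w ⊆ s₀
    w⊆s₀ = subst (_⊆ s₀) s₀∩s₁≡w (p∩q⊆p s₀ s₁)
    w⊆s₁ : w ⊆ s₁
    w⊆s₁ = subst (_⊆ s₁) s₁∩s₂≡w (p∩q⊆p s₁ s₂)
    w⊆s₂ : w ⊆ s₂
    w⊆s₂ = subst (_⊆ s₂) s₁∩s₂≡w (p∩q⊆q s₁ s₂)
    ∣w∪R∣≡k : ∀ {R} → FreshFor (k ∸ ∣ w ∣) s₀ s₁ s₂ R → ∣ w ∪ R ∣ ≡ k
    ∣w∪R∣≡k (∣R∣≡c , R∩s₀≡⊥ , _) =
      ∣p∪q∣≡k (≤-trans (p⊆q⇒∣p∣≤∣q∣ w⊆s₀) (≤-reflexive ∣s₀∣≡k)) ∣R∣≡c (Disjoint-sym (Disjoint-⊆ʳ w⊆s₀ R∩s₀≡⊥))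
    petal∩petal : ∀ {R R′} → FreshFor (k ∸ ∣ w ∣) s₀ s₁ s₂ R → FreshFor (k ∸ ∣ w ∣) s₀ s₁ s₂ R′ → Disjoint R R′ →
                  (w ∪ R) ∩ (w ∪ R′) ≡ w
    petal∩petal (_ , R∩s₀≡⊥ , _) (_ , R′∩s₀≡⊥ , _) R∩R′≡⊥ =
      trans ([p∪r]∩[q∪s]≡p∩q (Disjoint-⊆ʳ w⊆s₀ R∩s₀≡⊥) (Disjoint-sym (Disjoint-⊆ʳ w⊆s₀ R′∩s₀≡⊥)) R∩R′≡⊥) (∩-idem w)
    from-petals : Petals (suc (dezaBound r r)) (k ∸ ∣ w ∣) s₀ s₁ s₂ → E s₁ ∩ E s₂ ⊆ E s₀
    from-petals (L , ∣L∣≡1+D , fresh-L , disjoint-L) =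
      sunflower⇒E₁∩E₂⊆E₀ (map (w ∪_) L)
        (∣s₀∣≡k ∷ ∣s₁∣≡k ∷ ∣s₂∣≡k ∷ All.map⁺ (All.map ∣w∪R∣≡k fresh-L))
        ((s₀∩s₁≡w ∷ s₀∩s₂≡w ∷ All.map⁺ (All.map (λ (_ , R∩s₀≡⊥ , _) → x∩[w∪R]≡w w⊆s₀ R∩s₀≡⊥) fresh-L)) ∷
         (s₁∩s₂≡w ∷ All.map⁺ (All.map (λ (_ , _ , R∩s₁≡⊥ , _) → x∩[w∪R]≡w w⊆s₁ R∩s₁≡⊥) fresh-L)) ∷
         All.map⁺ (All.map (λ (_ , _ , _ , R∩s₂≡⊥) → x∩[w∪R]≡w w⊆s₂ R∩s₂≡⊥) fresh-L) ∷
         AllPairs.map⁺ (AllPairs-mapWithAll petal∩petal fresh-L disjoint-L))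
        (subst (dezaBound r r <_) (sym (trans (length-map (w ∪_) L) ∣L∣≡1+D)) ≤-refl)

  -- For fresh P and Q, the k-sets z, a ∪ P and b ∪ Q pairwise meet exactly in a ∩ b.
  Ebar∩Ebar⊆E : ∀ {a b z} → ∣ a ∣ ≡ ∣ b ∣ → ∣ a ∣ ≤ k → ∣ z ∣ ≡ k → z ∩ a ≡ a ∩ b → z ∩ b ≡ a ∩ b →
                Ebar k E a ∩ Ebar k E b ⊆ E z
  Ebar∩Ebar⊆E {a} {b} {z} ∣a∣≡∣b∣ ∣a∣≤k ∣z∣≡k z∩a≡w z∩b≡w =
    from-petals (petal-pair-around ∣a∣≤k ∣b∣≤k (≤-reflexive ∣z∣≡k) (k ∸ ∣ a ∣) (m∸n≤m k ∣ a ∣))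
    where
    ∣b∣≤k : ∣ b ∣ ≤ k
    ∣b∣≤k = subst (_≤ k) ∣a∣≡∣b∣ ∣a∣≤k
    from-petals : PetalPair (k ∸ ∣ a ∣) a b z → Ebar k E a ∩ Ebar k E b ⊆ E z
    from-petals (P , Q , (∣P∣≡c , P∩a≡⊥ , P∩b≡⊥ , P∩z≡⊥) , (∣Q∣≡c , Q∩a≡⊥ , Q∩b≡⊥ , Q∩z≡⊥) , P∩Q≡⊥) {e} e∈Ea∩Eb =
      E₁∩E₂⊆E₀ ∣z∣≡k ∣a∪P∣≡k ∣b∪Q∣≡k
        (trans (Disjoint⇒p∩[q∪r]≡p∩q a (Disjoint-sym P∩z≡⊥)) z∩a≡w)
        (trans (Disjoint⇒p∩[q∪r]≡p∩q b (Disjoint-sym Q∩z≡⊥)) z∩b≡w)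
        ([p∪r]∩[q∪s]≡p∩q P∩b≡⊥ (Disjoint-sym Q∩a≡⊥) P∩Q≡⊥)
        (x∈p∩q⁺ (∈Ebar⁻ k E a e∈Ea (a ∪ P) ∣a∪P∣≡k (p⊆p∪q P) , ∈Ebar⁻ k E b e∈Eb (b ∪ Q) ∣b∪Q∣≡k (p⊆p∪q Q)))
      where
      ∣a∪P∣≡k : ∣ a ∪ P ∣ ≡ k
      ∣a∪P∣≡k = ∣p∪q∣≡k ∣a∣≤k ∣P∣≡c (Disjoint-sym P∩a≡⊥)
      ∣b∪Q∣≡k : ∣ b ∪ Q ∣ ≡ k
      ∣b∪Q∣≡k = ∣p∪q∣≡k ∣b∣≤k (trans ∣Q∣≡c (cong (k ∸_) ∣a∣≡∣b∣)) (Disjoint-sym Q∩b≡⊥)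
      e∈Ea : e ∈ Ebar k E a
      e∈Ea = proj₁ (x∈p∩q⁻ (Ebar k E a) (Ebar k E b) e∈Ea∩Eb)
      e∈Eb : e ∈ Ebar k E b
      e∈Eb = proj₂ (x∈p∩q⁻ (Ebar k E a) (Ebar k E b) e∈Ea∩Eb)

  -- For fresh P and Q, the k-sets z, w ∪ P and w ∪ Q pairwise meet exactly in w = a ∩ b, and
  -- w ∪ P meets both a and b in w, so Ebar∩Ebar⊆E applies to it.
  Ebar∩Ebar⊆Ebar∩ : ∀ {a b} → ∣ a ∣ ≡ ∣ b ∣ → ∣ a ∣ ≤ k → Ebar k E a ∩ Ebar k E b ⊆ Ebar k E (a ∩ b)
  Ebar∩Ebar⊆Ebar∩ {a} {b} ∣a∣≡∣b∣ ∣a∣≤k {e} e∈Ea∩Eb = ∈Ebar⁺ k E (a ∩ b) λ z ∣z∣≡k w⊆z →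
    from-petals z ∣z∣≡k w⊆z (petal-pair-around ∣a∣≤k ∣b∣≤k (≤-reflexive ∣z∣≡k) (k ∸ ∣ a ∩ b ∣) (m∸n≤m k ∣ a ∩ b ∣))
    where
    ∣b∣≤k : ∣ b ∣ ≤ k
    ∣b∣≤k = subst (_≤ k) ∣a∣≡∣b∣ ∣a∣≤k
    w⊆a : a ∩ b ⊆ a
    w⊆a = p∩q⊆p a b
    w⊆b : a ∩ b ⊆ b
    w⊆b = p∩q⊆q a b
    ∣w∪R∣≡k : ∀ {R} → ∣ R ∣ ≡ k ∸ ∣ a ∩ b ∣ → Disjoint R a → ∣ (a ∩ b) ∪ R ∣ ≡ k
    ∣w∪R∣≡k ∣R∣≡c R∩a≡⊥ = ∣p∪q∣≡k (≤-trans (∣p∩q∣≤∣p∣ a b) ∣a∣≤k) ∣R∣≡c (Disjoint-sym (Disjoint-⊆ʳ w⊆a R∩a≡⊥))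
    ∈E-petal : ∀ {R} → ∣ R ∣ ≡ k ∸ ∣ a ∩ b ∣ → Disjoint R a → Disjoint R b → e ∈ E ((a ∩ b) ∪ R)
    ∈E-petal ∣R∣≡c R∩a≡⊥ R∩b≡⊥ = Ebar∩Ebar⊆E ∣a∣≡∣b∣ ∣a∣≤k (∣w∪R∣≡k ∣R∣≡c R∩a≡⊥)
      (trans (∩-comm _ a) (x∩[w∪R]≡w w⊆a R∩a≡⊥)) (trans (∩-comm _ b) (x∩[w∪R]≡w w⊆b R∩b≡⊥)) e∈Ea∩Eb
    from-petals : ∀ z → ∣ z ∣ ≡ k → a ∩ b ⊆ z → PetalPair (k ∸ ∣ a ∩ b ∣) a b z → e ∈ E z
    from-petals z ∣z∣≡k w⊆z (P , Q , (∣P∣≡c , P∩a≡⊥ , P∩b≡⊥ , P∩z≡⊥) , (∣Q∣≡c , Q∩a≡⊥ , Q∩b≡⊥ , Q∩z≡⊥) , P∩Q≡⊥) =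
      E₁∩E₂⊆E₀ ∣z∣≡k (∣w∪R∣≡k ∣P∣≡c P∩a≡⊥) (∣w∪R∣≡k ∣Q∣≡c Q∩a≡⊥)
        (x∩[w∪R]≡w w⊆z P∩z≡⊥) (x∩[w∪R]≡w w⊆z Q∩z≡⊥)
        (trans ([p∪r]∩[q∪s]≡p∩q (Disjoint-⊆ʳ w⊆a P∩a≡⊥) (Disjoint-sym (Disjoint-⊆ʳ w⊆a Q∩a≡⊥)) P∩Q≡⊥) (∩-idem (a ∩ b)))
        (x∈p∩q⁺ (∈E-petal ∣P∣≡c P∩a≡⊥ P∩b≡⊥ , ∈E-petal ∣Q∣≡c Q∩a≡⊥ Q∩b≡⊥))

  Ebar-∩ : ∀ {a b} → ∣ a ∣ ≡ ∣ b ∣ → ∣ a ∣ ≤ k → Ebar k E a ∩ Ebar k E b ≡ Ebar k E (a ∩ b)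
  Ebar-∩ {a} {b} ∣a∣≡∣b∣ ∣a∣≤k = ⊆-antisym (Ebar∩Ebar⊆Ebar∩ ∣a∣≡∣b∣ ∣a∣≤k)
    (λ e∈Ea∩b → x∈p∩q⁺ (Ebar-mono k E (p∩q⊆p a b) e∈Ea∩b , Ebar-mono k E (p∩q⊆q a b) e∈Ea∩b))

lemma3p5 : (k r : ℕ) → ∃ λ N → (n : ℕ) → N ≤ n → k < n →
    (m : ℕ) (g : ℕ → ℕ) (E : Subset n → Subset m) →
    MapsInto k r E → IsGCode k g E →
    (ℓ ℓ' : ℕ) → ℓ ≤ k →
    (𝓕 : Subset n → Set) → (∀ x → 𝓕 x → ∣ x ∣ ≡ ℓ) →
    (y : Subset n) → ∣ y ∣ ≡ ℓ' →
    IsSunflowerWithKernel 𝓕 y →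
    IsSunflowerWithKernel (ImageFamily (Ebar k E) 𝓕) (Ebar k E y)
lemma3p5 k r = threshold k r , λ n large _ m g E maps code ℓ _ ℓ≤k 𝓕 ∣𝓕∣≡ℓ y _ sunflower →
  λ { _ _ (a , a∈𝓕 , refl) (b , b∈𝓕 , refl) Ea≢Eb → begin
    Ebar k E a ∩ Ebar k E b ≡⟨ GCode.Ebar-∩ {g = g} maps code large {a} {b} (trans (∣𝓕∣≡ℓ a a∈𝓕) (sym (∣𝓕∣≡ℓ b b∈𝓕)))
                                                           (≤-trans (≤-reflexive (∣𝓕∣≡ℓ a a∈𝓕)) ℓ≤k) ⟩
    Ebar k E (a ∩ b)        ≡⟨ cong (Ebar k E) (sunflower a b a∈𝓕 b∈𝓕 (Ea≢Eb ∘ cong (Ebar k E))) ⟩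
    Ebar k E y              ∎ }
  where open ≡-Reasoning
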